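{- Let $\mathcal{L}''$, $\mathcal{L}'$ be logics, $\hat\tau$ a constructor translation from $\mathcal{L}''$ to $\mathcal{L}'$, $\mathrm{G}_{\mathcal{L}'}$ a Gentzen calculus for $\mathcal{L}'$, and $\mathrm{G}_{\mathcal{L}''\sqcup\mathcal{L}'}$ the Gentzen calculus for the coexistent combination induced by $\hat\tau$. If $\Psi',\Lambda'$ are finite multisets of formulas of $F_{\mathcal{L}'}$ with $\vdash_{\mathrm{G}_{\mathcal{L}'}}\Psi'\to\Lambda'$, then $\vdash_{\mathrm{G}_{\mathcal{L}''\sqcup\mathcal{L}'}}\Psi'\to\Lambda'$.
   Context: Syntax: a logic $\mathcal{L}$ has a signature $C_{\mathcal{L}}=(C_{\mathcal{L},n})_{n\in\mathbb{N}}$ ($C_{\mathcal{L},n}$ the $n$-ary constructors) and a denumerable set $P_{\mathcal{L}}$ of propositional symbols; $F_{\mathcal{L}}$ is the set of formulas built from $C_{\mathcal{L},0}\cup P_{\mathcal{L}}$ by the constructors. $\mathcal{A}_{\mathcal{L}}$ is the collection of maps on formulas generated from the maps $c^\bullet(\varphi_1,\dots,\varphi_n)=c(\varphi_1,\dots,\varphi_n)$ (and constants/propositional symbols as 0-argument maps) by composition, aggregation and projections. A constructor translation from $\mathcal{L}''$ to $\mathcal{L}'$ is an injective map $\hat\tau:C_{\mathcal{L}''}\cup P_{\mathcal{L}''}\to\mathcal{A}_{\mathcal{L}'}$ sending each $n$-ary constructor to an $n$-argument map, each propositional symbol to a 0-argument map, each 0-ary constructor to $c'^\bullet$ for some $c'\in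 C_{\mathcal{L}',0}$, and such that for all $p'',q''\in P_{\mathcal{L}''}$ there are $p',q'\in P_{\mathcal{L}'}$ with $p'$ occurring in $\hat\tau(p'')$ and $\hat\tau(q'')$ obtained from $\hat\tau(p'')$ by replacing $p'$ by $q'$. Symbols with $\hat\tau(c'')=c'^\bullet$ ($\tau$-identified symbols) are written with the same name in both logics, and these are exactly the symbols shared by the two signatures/sets of propositional symbols. The coexistent combination $\mathcal{L}''\sqcup\mathcal{L}'$ has propositional symbols $P_{\mathcal{L}'}$ and constructors $C_{0}=C_{\mathcal{L}'',0}\cup C_{\mathcal{L}',0}\cup(P_{\mathcal{L}''}\setminus P_{\mathcal{L}'})$, $C_n=C_{\mathcal{L}'',n}\cup C_{\mathcal{L}',n}$ for $n\ge1$. Gentzen calculi: a sequent is $\Gamma\to\Delta$ with $\Gamma,\Delta$ finite multisets of formulas. A rule has finitely many premises and a conclusion. Axioms are premise-free rules of the forms $p,\Gamma\to\Delta,p$; $c_1(p),\Gamma\to\Delta,c_1(p)$; $\Gamma\to\Delta,p,c_1(p)$; $\bot,\Gamma\to\Delta$ ($p$ a propositional symbol, $c_1$ unary, $\bot$ 0-ary). A left/right rule for $c$ has conclusion $c(\beta_1,\dots,\beta_n),\Gamma\to\Delta$ resp. $\Gamma\to\Delta,c(\beta_1,\dots,\beta_n)$; a left/right rule for a pair $c_1c$ ($c_1$ unary) has conclusion $c_1(c(\beta_1,\dots,\beta_n)),\Gamma\to\Delta$ resp. $\Gamma\to\Delta,c_1(c(\beta_1,\dots,\beta_n))$ (and then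 there are no rules for $c_1$ alone). A Gentzen calculus is a finite set of axioms and finite set of left and right rules, with the axiom $c_1(p),\Gamma\to\Delta,c_1(p)$ present iff $\Gamma\to\Delta,p,c_1(p)$ is present. In instances, metavariables $\Gamma,\Delta,\beta_i$ are replaced by formulas, but propositional symbols and constructors are fixed. A derivation of $\Psi\to\Lambda$ is a finite sequence of sequents starting with $\Psi\to\Lambda$ in which each sequent is an axiom instance or the conclusion of a rule instance whose premises occur later in the sequence; $\vdash_{\mathrm{G}}\Psi\to\Lambda$ means one exists. The calculus $\mathrm{G}_{\mathcal{L}''\sqcup\mathcal{L}'}$ consists of the axioms and rules of $\mathrm{G}_{\mathcal{L}'}$ (instantiated with formulas of $\mathcal{L}''\sqcup\mathcal{L}'$) together with: for each $p''\in P_{\mathcal{L}''}$ (when $P_{\mathcal{L}''}\ne P_{\mathcal{L}'}$) the rules from $\hat\tau(p''),\Gamma\to\Delta$ infer $p'',\Gamma\to\Delta$, and from $\Gamma\to\Delta,\hat\tau(p'')$ infer $\Gamma\to\Delta,p''$; and for each $c''\in C_{\mathcal{L}'',n}\setminus C_{\mathcal{L}',n}$ the rules from $\hat\tau(c'')(\beta_1,\dots,\beta_n),\Gamma\to\Delta$ infer $c''(\beta_1,\dots,\beta_n),\Gamma\to\Delta$, and from $\Gamma\to\Delta,\hat\tau(c'')(\beta_1,\dots,\beta_n)$ infer $\Gamma\to\Delta,c''(\beta_1,\dots,\beta_n)$. -}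

module Defs where

open import Data.Nat using (ℕ; zero; suc)
open import Data.Fin using (Fin; toℕ)
import Data.Nat as N
open import Data.Vec using (Vec; []; _∷_; tabulate)
open import Data.List using (List; []; _∷_; _++_; map; length; lookup)
open import Data.List.Relation.Binary.Permutation.Propositional using (_↭_)
open import Data.List.Relation.Unary.All using (All)
open import Data.List.Membership.Propositional using (_∈_)
open import Data.Product using (Σ; ∃; ∃-syntax; ∃₂; _×_; _,_)
open import Data.Sum using (_⊎_; inj₁; inj₂)
open import Data.Empty using (⊥)
open import Data.Bool using (Bool; true; false; if_then_else_)
open import Relation.Nullary using (¬_)
open import Relation.Binary.PropositionalEquality using (_≡_; _≢_)
open import Function.Bundles using (_↔_)

record Logic : Set₁ where
  field
    C : ℕ → Set
    P : Set
    P-denumerable : P ↔ ℕ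

-- n-argument maps of 𝒜_L, represented as terms with n argument slots
-- (var i = i-th projection, prop p = p^•, con c ts = composition of c^•
-- with the aggregation of ts).

module _ (L : Logic) where
  open Logic L

  data Term (n : ℕ) : Set where
    var  : Fin n → Term n
    prop : P → Term n
    con  : ∀ {k} → C k → Vec (Term n) k → Term n

Form : Logic → Set
Form L = Term L 0

module _ {L : Logic} where
  open Logic L

  mutual
    data Occurs (p : P) {n : ℕ} : Term L n → Set where
      occ-here : Occurs p (prop p)
      occ-con  : ∀ {k} {c : C k} {ts : Vec (Term L n) k} → OccursV p ts → Occurs p (con c ts)

    data OccursV (p : P) {n : ℕ} : ∀ {k} → Vec (Term L n) k → Set where
      occ-head : ∀ {k t} {ts : Vec (Term L n) k} → Occurs p t → OccursV p (t ∷ ts)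
      occ-tail : ∀ {k t} {ts : Vec (Term L n) k} → OccursV p ts → OccursV p (t ∷ ts)

  mutual
    data Replaced (p q : P) {n : ℕ} : Term L n → Term L n → Set where
      rep-var  : ∀ {i} → Replaced p q (var i) (var i)
      rep-hit  : Replaced p q (prop p) (prop q)
      rep-miss : ∀ {r} → r ≢ p → Replaced p q (prop r) (prop r)
      rep-con  : ∀ {k} {c : C k} {ts us : Vec (Term L n) k} →
                 ReplacedV p q ts us → Replaced p q (con c ts) (con c us)

    data ReplacedV (p q : P) {n : ℕ} : ∀ {k} → Vec (Term L n) k → Vec (Term L n) k → Set where
      repv-[] : ReplacedV p q [] []
      repv-∷  : ∀ {k t u} {ts us : Vec (Term L n) k} →
                Replaced p q t u → ReplacedV p q ts us → ReplacedV p q (t ∷ ts) (u ∷ us)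

  mutual
    inst : ∀ {n} → Vec (Form L) n → Term L n → Form L
    inst β (var i)    = Data.Vec.lookup β i
    inst β (prop p)   = prop p
    inst β (con c ts) = con c (instV β ts)

    instV : ∀ {n k} → Vec (Form L) n → Vec (Term L n) k → Vec (Form L) k
    instV β []       = []
    instV β (t ∷ ts) = inst β t ∷ instV β ts

-- Sequents (sides are lists considered up to permutation = multisets)

record Sequent (L : Logic) : Set where
  constructor _⇒_
  field
    ante : List (Form L)
    succ : List (Form L)

_≈ₛ_ : ∀ {L} → Sequent L → Sequent L → Set
(Γ ⇒ Δ) ≈ₛ (Γ' ⇒ Δ') = (Γ ↭ Γ') × (Δ ↭ Δ')

module _ (L : Logic) where
  open Logic L

  data Axiom : Set where
    ax-id  : P → Axiom
    ax-c1  : C 1 → P → Axiom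
    ax-ex  : C 1 → P → Axiom
    ax-bot : C 0 → Axiom

  data Side : Set where
    left right : Side

  data Head (n : ℕ) : Set where
    single : C n → Head n
    pair   : C 1 → C n → Head n

  record Premise (n : ℕ) : Set where
    field
      keepΓ  : Bool
      lefts  : List (Term L n)
      keepΔ  : Bool
      rights : List (Term L n)

  record Rule : Set where
    field
      arity    : ℕ
      side     : Side
      head     : Head arity
      premises : List (Premise arity)

  data IsPair (c1 : C 1) : ∀ {n} → Head n → Set where
    isPair : ∀ {n} {c : C n} → IsPair c1 (pair c1 c)

  data IsSingle (c1 : C 1) : ∀ {n} → Head n → Set where
    isSingle : IsSingle c1 (single c1)

  record Gentzen : Set where
    field
      axioms : List Axiom
      rules  : List Rule
      c1⇒ex  : ∀ c p → ax-c1 c p ∈ axioms → ax-ex c p ∈ axioms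
      ex⇒c1  : ∀ c p → ax-ex c p ∈ axioms → ax-c1 c p ∈ axioms
      pair⇒noSingle : ∀ (c1 : C 1) (r r' : Rule) → r ∈ rules → r' ∈ rules →
                      IsPair c1 (Rule.head r) → ¬ IsSingle c1 (Rule.head r')

  -- a (possibly infinite) family of axioms and rules, used for derivability
  record System : Set₁ where
    field
      AxIdx   : Set
      axiom   : AxIdx → Axiom
      RuleIdx : Set
      rule    : RuleIdx → Rule

  system : Gentzen → System
  system G = record
    { AxIdx = Fin (length (Gentzen.axioms G)) ; axiom = lookup (Gentzen.axioms G)
    ; RuleIdx = Fin (length (Gentzen.rules G)) ; rule = lookup (Gentzen.rules G) }

  axInst : Axiom → List (Form L) → List (Form L) → Sequent L
  axInst (ax-id p)    Γ Δ = (prop p ∷ Γ) ⇒ (Δ ++ prop p ∷ [])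
  axInst (ax-c1 c p)  Γ Δ = (con c (prop p ∷ []) ∷ Γ) ⇒ (Δ ++ con c (prop p ∷ []) ∷ [])
  axInst (ax-ex c p)  Γ Δ = Γ ⇒ (Δ ++ prop p ∷ con c (prop p ∷ []) ∷ [])
  axInst (ax-bot b)   Γ Δ = (con b [] ∷ Γ) ⇒ Δ

  headForm : ∀ {n} → Head n → Vec (Form L) n → Form L
  headForm (single c) β = con c β
  headForm (pair c1 c) β = con c1 (con c β ∷ [])

  conclInst : (r : Rule) → Vec (Form L) (Rule.arity r) → List (Form L) → List (Form L) → Sequent L
  conclInst r β Γ Δ with Rule.side r
  ... | left  = (headForm (Rule.head r) β ∷ Γ) ⇒ Δ
  ... | right = Γ ⇒ (Δ ++ headForm (Rule.head r) β ∷ [])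

  premInst : ∀ {n} → Premise n → Vec (Form L) n → List (Form L) → List (Form L) → Sequent L
  premInst pr β Γ Δ =
    ((if Premise.keepΓ pr then Γ else []) ++ map (inst β) (Premise.lefts pr)) ⇒
    ((if Premise.keepΔ pr then Δ else []) ++ map (inst β) (Premise.rights pr))

  -- derivations: finite sequences of sequents, each an axiom instance or the
  -- conclusion of a rule instance whose premises occur later in the sequence
  module _ (S : System) where
    open System S

    Justified : (ss : List (Sequent L)) → Fin (length ss) → Set
    Justified ss i =
      (Σ AxIdx λ a → ∃₂ λ Γ Δ → lookup ss i ≈ₛ axInst (axiom a) Γ Δ)
      ⊎
      (Σ RuleIdx λ r → Σ (Vec (Form L) (Rule.arity (rule r))) λ β → ∃₂ λ Γ Δ →
         (lookup ss i ≈ₛ conclInst (rule r) β Γ Δ) ×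
         All (λ pr → ∃[ j ] (toℕ i N.< toℕ j) × (lookup ss j ≈ₛ premInst pr β Γ Δ))
             (Rule.premises (rule r)))

    Derivable : Sequent L → Set
    Derivable s = Σ (List (Sequent L)) λ rest → ∀ i → Justified (s ∷ rest) i

record ConstructorTranslation (L'' L' : Logic) : Set where
  module L'' = Logic L''
  module L' = Logic L'
  field
    τC : ∀ {n} → L''.C n → Term L' n
    τP : L''.P → Term L' 0
    τC-inj : ∀ {n} {c d : L''.C n} → τC c ≡ τC d → c ≡ d
    τP-inj : ∀ {p q : L''.P} → τP p ≡ τP q → p ≡ q
    τCP-disj : ∀ (c : L''.C 0) (p : L''.P) → τC c ≢ τP p
    τ-nullary : ∀ (c : L''.C 0) → ∃[ c' ] τC c ≡ con c' []
    τ-props : ∀ (p q : L''.P) → ∃₂ λ p' q' → Occurs p' (τP p) × Replaced p' q' (τP p) (τP q)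

  IdC : ∀ {n} → L''.C n → Set
  IdC {n} c = ∃[ c' ] τC c ≡ con c' (tabulate var)

  IdP : L''.P → Set
  IdP p = ∃[ p' ] τP p ≡ prop p'

module Combination {L'' L' : Logic} (τ : ConstructorTranslation L'' L') where
  open ConstructorTranslation τ

  CombC : ℕ → Set
  CombC zero    = L'.C 0 ⊎ (Σ (L''.C 0) (λ c → ¬ IdC c) ⊎ Σ L''.P (λ p → ¬ IdP p))
  CombC (suc n) = L'.C (suc n) ⊎ Σ (L''.C (suc n)) (λ c → ¬ IdC c)

  Comb : Logic
  Comb = record { C = CombC ; P = L'.P ; P-denumerable = L'.P-denumerable }

  embC : ∀ {n} → L'.C n → CombC n
  embC {zero}  c = inj₁ c
  embC {suc n} c = inj₁ c

  newC : ∀ {n} → (c : L''.C n) → ¬ IdC c → CombC n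
  newC {zero}  c h = inj₂ (inj₁ (c , h))
  newC {suc n} c h = inj₂ (c , h)

  mutual
    emb : ∀ {n} → Term L' n → Term Comb n
    emb (var i)    = var i
    emb (prop p)   = prop p
    emb (con c ts) = con (embC c) (embV ts)

    embV : ∀ {n k} → Vec (Term L' n) k → Vec (Term Comb n) k
    embV []       = []
    embV (t ∷ ts) = emb t ∷ embV ts

  embAx : Axiom L' → Axiom Comb
  embAx (ax-id p)   = ax-id p
  embAx (ax-c1 c p) = ax-c1 (embC c) p
  embAx (ax-ex c p) = ax-ex (embC c) p
  embAx (ax-bot b)  = ax-bot (embC b)

  embSide : Side L' → Side Comb
  embSide left  = left
  embSide right = right

  embHead : ∀ {n} → Head L' n → Head Comb n
  embHead (single c)  = single (embC c)
  embHead (pair c1 c) = pair (embC c1) (embC c)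

  embPremise : ∀ {n} → Premise L' n → Premise Comb n
  embPremise pr = record
    { keepΓ = Premise.keepΓ pr ; lefts = map emb (Premise.lefts pr)
    ; keepΔ = Premise.keepΔ pr ; rights = map emb (Premise.rights pr) }

  embRule : Rule L' → Rule Comb
  embRule r = record
    { arity = Rule.arity r ; side = embSide (Rule.side r)
    ; head = embHead (Rule.head r) ; premises = map embPremise (Rule.premises r) }

  newPremise : ∀ {n} → Side Comb → Term Comb n → Premise Comb n
  newPremise left t  = record { keepΓ = true ; lefts = t ∷ [] ; keepΔ = true ; rights = [] }
  newPremise right t = record { keepΓ = true ; lefts = [] ; keepΔ = true ; rights = t ∷ [] }

  NewSym : Set
  NewSym = (Σ ℕ λ n → Σ (L''.C n) λ c → ¬ IdC c) ⊎ Σ L''.P (λ p → ¬ IdP p)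

  newRule : Side Comb → NewSym → Rule Comb
  newRule s (inj₁ (n , c , h)) = record
    { arity = n ; side = s ; head = single (newC c h)
    ; premises = newPremise s (emb (τC c)) ∷ [] }
  newRule s (inj₂ (p , h)) = record
    { arity = 0 ; side = s ; head = single (inj₂ (inj₂ (p , h)))
    ; premises = newPremise s (emb (τP p)) ∷ [] }

  combSystem : Gentzen L' → System Comb
  combSystem G = record
    { AxIdx = Fin (length (Gentzen.axioms G))
    ; axiom = λ a → embAx (lookup (Gentzen.axioms G) a)
    ; RuleIdx = Fin (length (Gentzen.rules G)) ⊎ (Side Comb × NewSym)
    ; rule = λ { (inj₁ r) → embRule (lookup (Gentzen.rules G) r)
               ; (inj₂ (s , x)) → newRule s x } }

{-# OPTIONS --safe #-}
-- The combined calculus contains every axiom and rule of G_L', and embedding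
-- formulas of L' into L'' ⊔ L' commutes with instantiating the schematic
-- formulas of a rule.  Hence embedding every sequent of a derivation turns
-- axiom instances into axiom instances and rule instances into rule
-- instances, so the image of a derivation is again a derivation.
module Submission where

open import Defs
open import Data.Bool using (if_then_else_)
open import Data.Bool.Properties using (if-float)
open import Data.Fin using (Fin; toℕ; cast; zero; suc)
open import Data.Fin.Properties using (toℕ-cast; cast-involutive)
open import Data.List using (List; []; _∷_; _++_; map; length; lookup)
open import Data.List.Membership.Propositional using (_∈_)
open import Data.List.Properties using (length-map; map-++; map-cong; map-∘)
import Data.List.Relation.Binary.Permutation.Propositional.Properties as ↭
open import Data.List.Relation.Unary.All as All using (All)
import Data.List.Relation.Unary.All.Properties as All
open import Data.Nat using (_<_)
open import Data.Product using (Σ; ∃-syntax; ∃₂; _×_; _,_)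
open import Data.Sum using (inj₁; inj₂)
open import Data.Vec using (Vec; []; _∷_)
import Data.Vec as Vec
open import Relation.Binary.PropositionalEquality
  using (_≡_; refl; sym; trans; cong; cong₂; subst₂; module ≡-Reasoning)

lookup-map : ∀ {A B : Set} (f : A → B) (xs : List A) (i : Fin (length (map f xs))) →
             lookup (map f xs) i ≡ f (lookup xs (cast (length-map f xs) i))
lookup-map f (x ∷ xs) zero    = refl
lookup-map f (x ∷ xs) (suc i) = lookup-map f xs i

module _ {L L₀ : Logic} (S : System L) (S₀ : System L₀) where
  open System
  open Rule using (arity; premises)

  record Simulation (F : Sequent L → Sequent L₀) : Set where
    field
      resp-≈ₛ   : ∀ {s t} → s ≈ₛ t → F s ≈ₛ F t
      axInst⁺   : ∀ a Γ Δ → Σ (AxIdx S₀) λ a₀ → ∃₂ λ Γ₀ Δ₀ →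
                  F (axInst L (axiom S a) Γ Δ) ≡ axInst L₀ (axiom S₀ a₀) Γ₀ Δ₀
      ruleInst⁺ : ∀ r β Γ Δ → Σ (RuleIdx S₀) λ r₀ → Σ (Vec (Form L₀) (arity (rule S₀ r₀))) λ β₀ →
                  ∃₂ λ Γ₀ Δ₀ →
                  (F (conclInst L (rule S r) β Γ Δ) ≡ conclInst L₀ (rule S₀ r₀) β₀ Γ₀ Δ₀) ×
                  All (λ pr₀ → ∃[ pr ] pr ∈ premises (rule S r) ×
                                       (F (premInst L pr β Γ Δ) ≡ premInst L₀ pr₀ β₀ Γ₀ Δ₀))
                      (premises (rule S₀ r₀))

  module _ {F : Sequent L → Sequent L₀} (sim : Simulation F) where
    open Simulation sim

    justified-map : ∀ ss i → Justified L S ss (cast (length-map F ss) i) →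
                    Justified L₀ S₀ (map F ss) i
    justified-map ss i (inj₁ (a , Γ , Δ , s≈ax)) with axInst⁺ a Γ Δ
    ... | a₀ , Γ₀ , Δ₀ , F-ax =
      inj₁ (a₀ , Γ₀ , Δ₀ , subst₂ _≈ₛ_ (sym (lookup-map F ss i)) F-ax (resp-≈ₛ s≈ax))
    justified-map ss i (inj₂ (r , β , Γ , Δ , s≈concl , later)) with ruleInst⁺ r β Γ Δ
    ... | r₀ , β₀ , Γ₀ , Δ₀ , F-concl , images =
      inj₂ (r₀ , β₀ , Γ₀ , Δ₀ ,
            subst₂ _≈ₛ_ (sym (lookup-map F ss i)) F-concl (resp-≈ₛ s≈concl) ,
            All.map (λ {pr₀} → image-later {pr₀}) images)
      where
      image-later : ∀ {pr₀} → ∃[ pr ] pr ∈ premises (rule S r) ×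
                                      (F (premInst L pr β Γ Δ) ≡ premInst L₀ pr₀ β₀ Γ₀ Δ₀) →
                    ∃[ j ] (toℕ i < toℕ j) × (lookup (map F ss) j ≈ₛ premInst L₀ pr₀ β₀ Γ₀ Δ₀)
      image-later (pr , pr∈ , F-prem) with All.lookup later pr∈
      ... | j , i′<j , sj≈prem =
        j₀ , subst₂ _<_ (toℕ-cast _ i) (sym (toℕ-cast _ j)) i′<j ,
        subst₂ _≈ₛ_ (sym lookup-j₀) F-prem (resp-≈ₛ sj≈prem)
        where
        j₀ : Fin (length (map F ss))
        j₀ = cast (sym (length-map F ss)) j

        lookup-j₀ : lookup (map F ss) j₀ ≡ F (lookup ss j)
        lookup-j₀ = trans (lookup-map F ss j₀) (cong (λ k → F (lookup ss k))
          (cast-involutive (length-map F ss) (sym (length-map F ss)) j))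

    derivable-map : ∀ {s} → Derivable L S s → Derivable L₀ S₀ (F s)
    derivable-map {s} (rest , der) =
      map F rest , λ i → justified-map (s ∷ rest) i (der _)

module _ {L'' L' : Logic} (τ : ConstructorTranslation L'' L') where
  open Combination τ

  emb-lookup : ∀ {n} (β : Vec (Form L') n) i → emb (Vec.lookup β i) ≡ Vec.lookup (embV β) i
  emb-lookup (b ∷ β) zero    = refl
  emb-lookup (b ∷ β) (suc i) = emb-lookup β i

  mutual
    emb-inst : ∀ {n} (β : Vec (Form L') n) t → emb (inst β t) ≡ inst (embV β) (emb t)
    emb-inst β (var i)    = emb-lookup β i
    emb-inst β (prop p)   = refl
    emb-inst β (con c ts) = cong (con (embC c)) (emb-instV β ts)

    emb-instV : ∀ {n k} (β : Vec (Form L') n) (ts : Vec (Term L' n) k) →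
                embV (instV β ts) ≡ instV (embV β) (embV ts)
    emb-instV β []       = refl
    emb-instV β (t ∷ ts) = cong₂ _∷_ (emb-inst β t) (emb-instV β ts)

  map-emb-inst : ∀ {n} (β : Vec (Form L') n) ts →
                 map emb (map (inst β) ts) ≡ map (inst (embV β)) (map emb ts)
  map-emb-inst β ts = begin
    map emb (map (inst β) ts)            ≡⟨ map-∘ ts ⟨
    map (λ t → emb (inst β t)) ts        ≡⟨ map-cong (emb-inst β) ts ⟩
    map (λ t → inst (embV β) (emb t)) ts ≡⟨ map-∘ ts ⟩
    map (inst (embV β)) (map emb ts)     ∎
    where open ≡-Reasoning

  embSeq : Sequent L' → Sequent Comb
  embSeq (Γ ⇒ Δ) = map emb Γ ⇒ map emb Δ

  embSeq-resp-≈ₛ : ∀ {s t} → s ≈ₛ t → embSeq s ≈ₛ embSeq t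
  embSeq-resp-≈ₛ {_ ⇒ _} {_ ⇒ _} (Γ↭Γ′ , Δ↭Δ′) = ↭.map⁺ emb Γ↭Γ′ , ↭.map⁺ emb Δ↭Δ′

  embSeq-axInst : ∀ a Γ Δ →
                  embSeq (axInst L' a Γ Δ) ≡ axInst Comb (embAx a) (map emb Γ) (map emb Δ)
  embSeq-axInst (ax-id p)   Γ Δ = cong (_ ⇒_) (map-++ emb Δ _)
  embSeq-axInst (ax-c1 c p) Γ Δ = cong (_ ⇒_) (map-++ emb Δ _)
  embSeq-axInst (ax-ex c p) Γ Δ = cong (_ ⇒_) (map-++ emb Δ _)
  embSeq-axInst (ax-bot b)  Γ Δ = refl

  emb-headForm : ∀ {n} (h : Head L' n) β → emb (headForm L' h β) ≡ headForm Comb (embHead h) (embV β)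
  emb-headForm (single c)  β = refl
  emb-headForm (pair c1 c) β = refl

  embSeq-conclInst : ∀ r β Γ Δ →
    embSeq (conclInst L' r β Γ Δ) ≡ conclInst Comb (embRule r) (embV β) (map emb Γ) (map emb Δ)
  embSeq-conclInst record { side = left ; head = h } β Γ Δ =
    cong (λ φ → (φ ∷ map emb Γ) ⇒ map emb Δ) (emb-headForm h β)
  embSeq-conclInst record { side = right ; head = h } β Γ Δ =
    cong (map emb Γ ⇒_)
      (trans (map-++ emb Δ _) (cong (λ φ → map emb Δ ++ φ ∷ []) (emb-headForm h β)))

  emb-premSide : ∀ {n} (β : Vec (Form L') n) k Γ ts →
    map emb ((if k then Γ else []) ++ map (inst β) ts) ≡
    (if k then map emb Γ else []) ++ map (inst (embV β)) (map emb ts)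
  emb-premSide β k Γ ts =
    trans (map-++ emb (if k then Γ else []) _)
          (cong₂ _++_ (if-float (map emb) k) (map-emb-inst β ts))

  embSeq-premInst : ∀ {n} (pr : Premise L' n) β Γ Δ →
    embSeq (premInst L' pr β Γ Δ) ≡ premInst Comb (embPremise pr) (embV β) (map emb Γ) (map emb Δ)
  embSeq-premInst pr β Γ Δ = cong₂ _⇒_
    (emb-premSide β (Premise.keepΓ pr) Γ (Premise.lefts pr))
    (emb-premSide β (Premise.keepΔ pr) Δ (Premise.rights pr))

  embSeq-simulation : (G : Gentzen L') → Simulation (system L' G) (combSystem G) embSeq
  embSeq-simulation G = record
    { resp-≈ₛ   = embSeq-resp-≈ₛ
    ; axInst⁺   = λ a Γ Δ → a , map emb Γ , map emb Δ , embSeq-axInst (lookup axioms a) Γ Δ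
    ; ruleInst⁺ = λ r β Γ Δ →
        inj₁ r , embV β , map emb Γ , map emb Δ , embSeq-conclInst (lookup rules r) β Γ Δ ,
        All.map⁺ (All.tabulate λ {pr} pr∈ → pr , pr∈ , embSeq-premInst pr β Γ Δ)
    }
    where open Gentzen G

mainTheorem2 : (L'' L' : Logic) (τ : ConstructorTranslation L'' L') (G : Gentzen L')
    (Ψ Λ : List (Form L')) →
    Derivable L' (system L' G) (Ψ ⇒ Λ) →
    Derivable (Combination.Comb τ) (Combination.combSystem τ G)
      (map (Combination.emb τ) Ψ ⇒ map (Combination.emb τ) Λ)
mainTheorem2 L'' L' τ G Ψ Λ =
  derivable-map (system L' G) (Combination.combSystem τ G) (embSeq-simulation τ G)
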